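{- For every positive integer $n$, $\chi_{\mu_2}(Q_n)\le \gamma(Q_n)$.
   Context: $Q_n$ is the $n$-dimensional hypercube: vertices are binary $n$-tuples, two adjacent iff they differ in exactly one coordinate. $\gamma$ denotes the domination number. A $u,v$-geodesic is a shortest $u,v$-path. A set $M\subseteq V(X)$ is a $2$-distance mutual-visibility set of $X$ if for every two distinct $u,v\in M$ there is a $u,v$-geodesic of length at most $2$ none of whose internal vertices lies in $M$; $\chi_{\mu_2}(X)$ is the minimum number of parts in a partition of $V(X)$ into such sets. -}

module Defs where

open import Data.Nat using (ℕ; _≤_)
open import Data.Bool using (Bool)
open import Data.Fin using (Fin)
open import Data.Vec using (Vec; lookup)
open import Data.List using (List; length)
open import Data.List.Membership.Propositional using (_∈_)
open import Data.List.Relation.Unary.Unique.Propositional using (Unique)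
open import Data.List.Relation.Unary.Any using (Any)
open import Data.Product using (Σ; _×_)
open import Data.Sum using (_⊎_)
open import Relation.Nullary using (¬_)
open import Relation.Binary.PropositionalEquality using (_≡_; _≢_)

QV : ℕ → Set
QV n = Vec Bool n

QAdj : {n : ℕ} → QV n → QV n → Set
QAdj {n} u v = Σ (Fin n) λ i →
  (lookup u i ≢ lookup v i) × (∀ j → j ≢ i → lookup u j ≡ lookup v j)

Dominating : {V : Set} → (V → V → Set) → List V → Set
Dominating {V} Adj D = ∀ (x : V) → x ∈ D ⊎ Any (λ d → Adj d x) D

IsDominationNumber : {V : Set} → (V → V → Set) → ℕ → Set
IsDominationNumber {V} Adj g =
  Σ (List V) (λ D → Unique D × Dominating Adj D × length D ≡ g)
  × (∀ (D : List V) → Unique D → Dominating Adj D → g ≤ length D)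

-- There is a u,v-geodesic of length at most 2 with no internal vertex in M
-- (for u ≢ v): either u,v adjacent (geodesic of length 1, no internal
-- vertices), or d(u,v) = 2 (u,v non-adjacent) and a common neighbour w
-- (internal vertex of the geodesic u-w-v) lies outside M.
Visible2 : {V : Set} → (V → V → Set) → (V → Set) → V → V → Set
Visible2 {V} Adj M u v =
  Adj u v ⊎ ((¬ Adj u v) × Σ V (λ w → Adj u w × Adj w v × ¬ M w))

Is2DistMV : {V : Set} → (V → V → Set) → (V → Set) → Set
Is2DistMV {V} Adj M =
  ∀ (u v : V) → M u → M v → u ≢ v → Visible2 Adj M u v

-- a partition of V into (at most) k 2-distance mutual-visibility sets,
-- given as the map assigning to each vertex the index of its part
HasMV2Partition : {V : Set} → (V → V → Set) → ℕ → Set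
HasMV2Partition {V} Adj k =
  Σ (V → Fin k) λ c → ∀ (i : Fin k) → Is2DistMV Adj (λ x → c x ≡ i)

IsChiMu2 : {V : Set} → (V → V → Set) → ℕ → Set
IsChiMu2 Adj χ =
  HasMV2Partition Adj χ × (∀ (k : ℕ) → HasMV2Partition Adj k → χ ≤ k)

-- Every vertex lies in the closed neighbourhood N[d] of some vertex d of a
-- minimum dominating set D, so assigning each vertex to such a d partitions
-- V(Q_n) into |D| = γ(Q_n) parts, each contained in a closed neighbourhood.
-- It therefore suffices that every subset of N[d] is a 2-distance
-- mutual-visibility set. Two neighbours d + e_i and d + e_j of d are at
-- distance 2, and besides d they have the common neighbour d + e_i + e_j,
-- which lies at distance 2 from d and hence outside N[d].
module Submission where

open import Defs
open import Data.Nat using (ℕ; _≤_)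
open import Data.Bool using (not)
open import Data.Bool.Properties using (not-¬; ¬-not)
open import Data.Fin using (Fin; _≟_)
open import Data.Vec using (lookup; updateAt; tabulate)
open import Data.Vec.Properties
  using (lookup∘updateAt; lookup∘updateAt′; updateAt-commutes; tabulate∘lookup; tabulate-cong)
open import Data.List using (length)
import Data.List as List
open import Data.List.Relation.Unary.Any as Any using (Any)
open import Data.List.Relation.Unary.Any.Properties using (lookup-index)
open import Data.Product using (_,_; ∃-syntax)
open import Data.Sum using (_⊎_; inj₁; inj₂)
open import Relation.Nullary using (¬_; yes; no; contradiction)
open import Relation.Binary.PropositionalEquality

module _ {V : Set} (Adj : V → V → Set) where

  ClosedNbhd : V → V → Set
  ClosedNbhd d x = d ≡ x ⊎ Adj d x

  Visible2-anti : ∀ {M M′ : V → Set} {u v} → (∀ {x} → M′ x → M x) →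
    Visible2 Adj M u v → Visible2 Adj M′ u v
  Visible2-anti M′⊆M (inj₁ u~v) = inj₁ u~v
  Visible2-anti M′⊆M (inj₂ (u≁v , w , u~w , w~v , w∉M)) =
    inj₂ (u≁v , w , u~w , w~v , λ w∈M′ → w∉M (M′⊆M w∈M′))

  Is2DistMV-anti : ∀ {M M′ : V → Set} → (∀ {x} → M′ x → M x) →
    Is2DistMV Adj M → Is2DistMV Adj M′
  Is2DistMV-anti M′⊆M mv u v u∈M′ v∈M′ u≢v =
    Visible2-anti M′⊆M (mv u v (M′⊆M u∈M′) (M′⊆M v∈M′) u≢v)

  Dominating⇒ClosedNbhd-cover : ∀ {D} → Dominating Adj D →
    ∀ x → Any (λ d → ClosedNbhd d x) D
  Dominating⇒ClosedNbhd-cover dom x with dom x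
  ... | inj₁ x∈D = Any.map (λ x≡d → inj₁ (sym x≡d)) x∈D
  ... | inj₂ d~x = Any.map inj₂ d~x

  Dominating⇒HasMV2Partition : (∀ d → Is2DistMV Adj (ClosedNbhd d)) →
    ∀ {D} → Dominating Adj D → HasMV2Partition Adj (length D)
  Dominating⇒HasMV2Partition closed-mv {D} dom = part , part-mv
    where
    part : V → Fin (length D)
    part x = Any.index (Dominating⇒ClosedNbhd-cover dom x)

    part⊆ClosedNbhd : ∀ {i x} → part x ≡ i → ClosedNbhd (List.lookup D i) x
    part⊆ClosedNbhd {x = x} refl = lookup-index (Dominating⇒ClosedNbhd-cover dom x)

    part-mv : ∀ i → Is2DistMV Adj (λ x → part x ≡ i)
    part-mv i = Is2DistMV-anti part⊆ClosedNbhd (closed-mv (List.lookup D i))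

  χμ₂≤γ : (∀ d → Is2DistMV Adj (ClosedNbhd d)) →
    ∀ {χ g} → IsChiMu2 Adj χ → IsDominationNumber Adj g → χ ≤ g
  χμ₂≤γ closed-mv (_ , χ-min) ((D , _ , dom , refl) , _) =
    χ-min (length D) (Dominating⇒HasMV2Partition closed-mv dom)

private
  variable
    n : ℕ

flip : Fin n → QV n → QV n
flip i u = updateAt u i not

flip-differs : ∀ i (u : QV n) → lookup (flip i u) i ≢ lookup u i
flip-differs i u eq = not-¬ refl (sym (trans (sym (lookup∘updateAt i u)) eq))

flip-agrees : ∀ {i j} (u : QV n) → j ≢ i → lookup (flip i u) j ≡ lookup u j
flip-agrees {i = i} {j} u j≢i = lookup∘updateAt′ j i j≢i u

QAdj-sym : {u v : QV n} → QAdj u v → QAdj v u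
QAdj-sym (i , differ , agree) = i , (λ eq → differ (sym eq)) , (λ j j≢i → sym (agree j j≢i))

QAdj-flip : ∀ i (u : QV n) → QAdj u (flip i u)
QAdj-flip i u = i , (λ eq → flip-differs i u (sym eq)) , (λ j j≢i → sym (flip-agrees u j≢i))

QAdj⇒flip : {u v : QV n} → QAdj u v → ∃[ i ] v ≡ flip i u
QAdj⇒flip {u = u} {v} (i , differ , agree) = i , (begin
  v                            ≡⟨ tabulate∘lookup v ⟨
  tabulate (lookup v)          ≡⟨ tabulate-cong lookup-v≗ ⟩
  tabulate (lookup (flip i u)) ≡⟨ tabulate∘lookup (flip i u) ⟩
  flip i u                     ∎)
  where
  open ≡-Reasoning
  lookup-v≗ : ∀ j → lookup v j ≡ lookup (flip i u) j
  lookup-v≗ j with j ≟ i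
  ... | yes refl = trans (¬-not (λ eq → differ (sym eq))) (sym (lookup∘updateAt j u))
  ... | no j≢i = trans (sym (agree j j≢i)) (sym (flip-agrees u j≢i))

differ-at-two⇒¬QAdj : ∀ {i j} {x y : QV n} → i ≢ j →
  lookup x i ≢ lookup y i → lookup x j ≢ lookup y j → ¬ QAdj x y
differ-at-two⇒¬QAdj {i = i} {j} i≢j differ-i differ-j (k , _ , agree) with k ≟ i
... | no k≢i = differ-i (agree i (λ i≡k → k≢i (sym i≡k)))
... | yes refl = differ-j (agree j (λ j≡k → i≢j (sym j≡k)))

flip-neighbours-visible : ∀ {i j} (d : QV n) → i ≢ j →
  Visible2 QAdj (ClosedNbhd QAdj d) (flip i d) (flip j d)
flip-neighbours-visible {i = i} {j} d i≢j =
  inj₂ (u≁v , w , QAdj-flip j u , w~v , w∉N[d])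
  where
  u = flip i d
  v = flip j d
  w = flip j u

  j≢i : j ≢ i
  j≢i j≡i = i≢j (sym j≡i)

  u≁v : ¬ QAdj u v
  u≁v = differ-at-two⇒¬QAdj {x = u} {v} i≢j
    (λ eq → flip-differs i d (trans eq (flip-agrees d i≢j)))
    (λ eq → flip-differs j d (trans (sym eq) (flip-agrees d j≢i)))

  w~v : QAdj w v
  w~v = subst (λ x → QAdj x v) (updateAt-commutes i j i≢j d) (QAdj-sym {u = v} {flip i v} (QAdj-flip i v))

  w-differs-i : lookup d i ≢ lookup w i
  w-differs-i eq = flip-differs i d (trans (sym (flip-agrees u i≢j)) (sym eq))

  w-differs-j : lookup d j ≢ lookup w j
  w-differs-j eq = flip-differs j u (trans (sym eq) (sym (flip-agrees d j≢i)))

  w∉N[d] : ¬ ClosedNbhd QAdj d w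
  w∉N[d] (inj₁ d≡w) = w-differs-i (cong (λ x → lookup x i) d≡w)
  w∉N[d] (inj₂ d~w) = differ-at-two⇒¬QAdj {x = d} {w} i≢j w-differs-i w-differs-j d~w

ClosedNbhd-is2DistMV : (d : QV n) → Is2DistMV QAdj (ClosedNbhd QAdj d)
ClosedNbhd-is2DistMV d u v (inj₁ refl) (inj₁ refl) u≢v = contradiction refl u≢v
ClosedNbhd-is2DistMV d u v (inj₁ refl) (inj₂ d~v) _ = inj₁ d~v
ClosedNbhd-is2DistMV d u v (inj₂ d~u) (inj₁ refl) _ = inj₁ (QAdj-sym {u = d} {u} d~u)
ClosedNbhd-is2DistMV d u v (inj₂ d~u) (inj₂ d~v) u≢v
  with QAdj⇒flip {u = d} {u} d~u | QAdj⇒flip {u = d} {v} d~v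
... | i , refl | j , refl with i ≟ j
...   | yes refl = contradiction refl u≢v
...   | no i≢j = flip-neighbours-visible d i≢j

proposition6p3 : (n : ℕ) → 1 ≤ n → (χ g : ℕ) →
    IsChiMu2 (QAdj {n}) χ → IsDominationNumber (QAdj {n}) g → χ ≤ g
proposition6p3 n _ χ g = χμ₂≤γ QAdj ClosedNbhd-is2DistMV
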